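{- Let $p$ be a prime and $m\ge 2$. Then (i) $\phi(C_{p^m})=\phi(C_{p^{m-1}})+\phi(p^m)^2$; (ii) $\phi(C_{p^{m-1}}\times C_p)=p\,\phi(C_{p^{m-1}})+(p-1)(p-2)$.
   Context: $C_k$ is the cyclic group of order $k$, $o(g)$ the order of $g$, $\phi$ applied to an integer is Euler's totient function, and for a finite group $G$, $\phi(G)=\sum_{g\in G}\phi(o(g))$. -}

module Defs where

open import Data.Nat using (ℕ; zero; suc; _+_; _*_; _≟_)
open import Data.Nat.DivMod using (_mod_)
open import Data.Nat.GCD using (gcd)
open import Data.Fin using (Fin; toℕ)
import Data.Fin.Properties as FinP
open import Data.List using (List; []; _∷_; map; filter; length; upTo; allFin; cartesianProduct)
open import Data.Nat.ListAction using (sum)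
open import Data.Product using (_×_; _,_)
import Data.Product.Properties as ProdP
open import Relation.Binary.PropositionalEquality using (_≡_)
open import Relation.Binary.Definitions using (DecidableEquality)
open import Relation.Nullary using (yes; no)

totient : ℕ → ℕ
totient n = length (filter (λ k → gcd k n ≟ 1) (map suc (upTo n)))

-- A finite group presented concretely: carrier with decidable equality,
-- operation, identity, and a list enumerating each element exactly once.
record FiniteGroup : Set₁ where
  field
    Carrier  : Set
    _∙_      : Carrier → Carrier → Carrier
    ε        : Carrier
    _≟G_     : DecidableEquality Carrier
    elements : List Carrier

  pow : ℕ → Carrier → Carrier
  pow zero    g = ε
  pow (suc d) g = g ∙ pow d g

  leastFrom : ℕ → ℕ → Carrier → ℕ
  leastFrom d zero        g = 0
  leastFrom d (suc fuel)  g with pow d g ≟G ε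
  ... | yes _ = d
  ... | no  _ = leastFrom (suc d) fuel g

  -- order of g: least d ≥ 1 with g^d = ε; searching d ∈ [1 .. |G|]
  -- suffices since o(g) ≤ |G|.
  order : Carrier → ℕ
  order g = leastFrom 1 (length elements) g

  phiG : ℕ
  phiG = sum (map (λ g → totient (order g)) elements)

open FiniteGroup public using (order; phiG)

-- Cyclic group C_k = ℤ/kℤ (additive), for k ≥ 1.  (C 0 is a junk value,
-- the trivial group; it is never used since only k = p^j ≥ 1 occurs.)
C : ℕ → FiniteGroup
C zero = record
  { Carrier = Fin 1 ; _∙_ = λ a b → a ; ε = Fin.zero
  ; _≟G_ = FinP._≟_ ; elements = allFin 1 }
  where import Data.Fin as Fin
C (suc k) = record
  { Carrier  = Fin (suc k)
  ; _∙_      = λ a b → (toℕ a + toℕ b) mod (suc k)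
  ; ε        = Fin.zero
  ; _≟G_     = FinP._≟_
  ; elements = allFin (suc k) }
  where import Data.Fin as Fin

_×G_ : FiniteGroup → FiniteGroup → FiniteGroup
G ×G H = record
  { Carrier  = G.Carrier × H.Carrier
  ; _∙_      = λ { (a , b) (c , d) → (a G.∙ c) , (b H.∙ d) }
  ; ε        = G.ε , H.ε
  ; _≟G_     = ProdP.≡-dec G._≟G_ H._≟G_
  ; elements = cartesianProduct G.elements H.elements }
  where
    module G = FiniteGroup G
    module H = FiniteGroup H

-- Write n = p·q with q = p^j and split [0, n) into the q blocks {i·p + r | r < p}.
-- A residue x with p ∤ x generates C_n, while i·p has the same order in C_n as i
-- in C_q; so block i contributes φ(o(i)) + (p − 1)·φ(n), and
-- φ(C_n) = φ(C_q) + q·(p − 1)·φ(n) = φ(C_q) + φ(n)², as the same block count gives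
-- φ(n) = q·(p − 1).  In C_q × C_p an element (a, b) with a ≠ 0 has the order of a,
-- since p divides that order; the row a = 0 holds the identity and p − 1 elements
-- of order p, so φ(C_q × C_p) = p·φ(C_q) − p + 1 + (p − 1)².

module Submission where

open import Defs
open import Data.Nat using (ℕ; zero; suc; _+_; _*_; _∸_; _^_; _≤_; _<_; z≤n; s≤s; _≟_; NonZero; >-nonZero)
open import Data.Nat.Properties
open import Algebra.Properties.CommutativeSemigroup +-commutativeSemigroup using (interchange)
open import Data.Nat.DivMod using (_%_; _mod_; %-distribˡ-+; %-distribˡ-*; m%n%n≡m%n; m<n⇒m%n≡m)
open import Data.Nat.Divisibility
open import Data.Nat.Primality using (Prime; ¬prime[0]; ¬prime[1]; prime⇒irreducible)
open import Data.Nat.Coprimality using (Coprime; coprime-divisor; coprime⇒gcd≡1)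
import Data.Nat.Coprimality as Coprimality
open import Data.Nat.GCD using (gcd; gcd-greatest)
open import Data.Nat.ListAction using (sum)
import Data.Nat.ListAction.Properties as Sum
open import Data.Nat.Tactic.RingSolver using (solve-∀)
open import Data.Fin as Fin using (Fin; toℕ)
import Data.Fin.Properties as Finₚ
open import Data.List using (List; []; _∷_; map; filter; length; tabulate; allFin; applyUpTo; cartesianProduct; _++_)
open import Data.List.Properties using (map-++; length-++; length-map; map-∘; map-tabulate; length-tabulate; map-upTo)
open import Data.Product using (_×_; _,_; proj₁; proj₂)
open import Data.Sum using (inj₁; inj₂)
open import Function using (_∘_)
open import Function.Bundles using (_⇔_; mk⇔; module Equivalence)
open import Relation.Nullary using (¬_; Dec; yes; no; contradiction)
open import Relation.Unary using (Pred; Decidable)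
open import Relation.Binary.PropositionalEquality
open import Relation.Binary.Definitions using (tri<; tri≈; tri>)

open Equivalence using (to; from)
open FiniteGroup using (Carrier; ε; pow; leastFrom; elements)
open ≡-Reasoning

record LeastPositive (P : ℕ → Set) (r : ℕ) : Set where
  constructor leastPositive
  field
    positive : 1 ≤ r
    holds    : P r
    least    : ∀ {e} → 1 ≤ e → e < r → ¬ P e

module _ {P : ℕ → Set} where

  leastPositive-intro : ∀ {r} → 1 ≤ r → P r → (∀ {e} → 1 ≤ e → P e → r ≤ e) → LeastPositive P r
  leastPositive-intro 1≤r Pr minimal = leastPositive 1≤r Pr (λ 1≤e e<r Pe → <⇒≱ e<r (minimal 1≤e Pe))

  leastPositive-unique : ∀ {r s} → LeastPositive P r → LeastPositive P s → r ≡ s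
  leastPositive-unique {r} {s} (leastPositive 1≤r Pr least-r) (leastPositive 1≤s Ps least-s) with <-cmp r s
  ... | tri< r<s _ _ = contradiction Pr (least-s 1≤r r<s)
  ... | tri≈ _ r≡s _ = r≡s
  ... | tri> _ _ s<r = contradiction Ps (least-r 1≤s s<r)

  leastPositive-resp-⇔ : ∀ {Q : ℕ → Set} {r} → (∀ d → P d ⇔ Q d) → LeastPositive P r → LeastPositive Q r
  leastPositive-resp-⇔ P⇔Q (leastPositive 1≤r Pr least) =
    leastPositive 1≤r (to (P⇔Q _) Pr) (λ 1≤e e<r Qe → least 1≤e e<r (from (P⇔Q _) Qe))

module _ (G : FiniteGroup) {P : ℕ → Set} {g : Carrier G} (pow≡ε⇔P : ∀ d → pow G d g ≡ ε G ⇔ P d) where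

  leastFrom-leastPositive : ∀ fuel {d w} → 1 ≤ d → (∀ {e} → 1 ≤ e → e < d → ¬ P e) →
    d ≤ w → w < d + fuel → P w → LeastPositive P (leastFrom G d fuel g)
  leastFrom-leastPositive zero {d} _ _ d≤w w<d+0 _ = contradiction (subst (_≤ _) (sym (+-identityʳ d)) d≤w) (<⇒≱ w<d+0)
  leastFrom-leastPositive (suc fuel) {d} {w} 1≤d below d≤w w<d+1+fuel Pw with FiniteGroup._≟G_ G (pow G d g) (ε G)
  ... | yes d-kills = leastPositive 1≤d (to (pow≡ε⇔P d) d-kills) below
  ... | no ¬d-kills =
    leastFrom-leastPositive fuel (s≤s z≤n) below′ (≤∧≢⇒< d≤w (λ { refl → ¬Pd Pw }))
      (subst (w <_) (+-suc d fuel) w<d+1+fuel) Pw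
    where
    ¬Pd : ¬ P d
    ¬Pd = ¬d-kills ∘ from (pow≡ε⇔P d)
    below′ : ∀ {e} → 1 ≤ e → e < suc d → ¬ P e
    below′ 1≤e (s≤s e≤d) with m≤n⇒m<n∨m≡n e≤d
    ... | inj₁ e<d  = below 1≤e e<d
    ... | inj₂ refl = ¬Pd

  order-leastPositive : ∀ {w} → 1 ≤ w → w ≤ length (elements G) → P w → LeastPositive P (order G g)
  order-leastPositive 1≤w w≤|G| =
    leastFrom-leastPositive (length (elements G)) ≤-refl (λ 1≤e e<1 → contradiction 1≤e (<⇒≱ e<1)) 1≤w (s≤s w≤|G|)

pow-×G : ∀ (G H : FiniteGroup) d {a b} → pow (G ×G H) d (a , b) ≡ (pow G d a , pow H d b)
pow-×G G H zero          = refl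
pow-×G G H (suc d) {a} {b} rewrite pow-×G G H d {a} {b} = refl

∑< : ℕ → (ℕ → ℕ) → ℕ
∑< zero    f = 0
∑< (suc n) f = f 0 + ∑< n (f ∘ suc)

∑<-cong : ∀ n {f g : ℕ → ℕ} → (∀ x → x < n → f x ≡ g x) → ∑< n f ≡ ∑< n g
∑<-cong zero    f≡g = refl
∑<-cong (suc n) f≡g = cong₂ _+_ (f≡g 0 (s≤s z≤n)) (∑<-cong n (λ x x<n → f≡g (suc x) (s≤s x<n)))

∑<-distrib-+ : ∀ n (f g : ℕ → ℕ) → ∑< n (λ x → f x + g x) ≡ ∑< n f + ∑< n g
∑<-distrib-+ zero    f g = refl
∑<-distrib-+ (suc n) f g = begin
  f 0 + g 0 + ∑< n (λ x → f (suc x) + g (suc x))  ≡⟨ cong (f 0 + g 0 +_) (∑<-distrib-+ n (f ∘ suc) (g ∘ suc)) ⟩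
  f 0 + g 0 + (∑< n (f ∘ suc) + ∑< n (g ∘ suc))   ≡⟨ interchange (f 0) (g 0) _ _ ⟩
  f 0 + ∑< n (f ∘ suc) + (g 0 + ∑< n (g ∘ suc))   ∎

∑<-const : ∀ n c → ∑< n (λ _ → c) ≡ n * c
∑<-const zero    c = refl
∑<-const (suc n) c = cong (c +_) (∑<-const n c)

∑<-*ˡ : ∀ n c (f : ℕ → ℕ) → ∑< n (λ x → c * f x) ≡ c * ∑< n f
∑<-*ˡ zero    c f = sym (*-zeroʳ c)
∑<-*ˡ (suc n) c f = trans (cong (c * f 0 +_) (∑<-*ˡ n c (f ∘ suc))) (sym (*-distribˡ-+ c (f 0) _))

∑<-suc : ∀ n (f : ℕ → ℕ) → ∑< (suc n) f ≡ ∑< n f + f n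
∑<-suc zero    f = +-comm (f 0) 0
∑<-suc (suc n) f = trans (cong (f 0 +_) (∑<-suc n (f ∘ suc))) (sym (+-assoc (f 0) _ _))

∑<-shift : ∀ n (f : ℕ → ℕ) → f 0 ≡ f n → ∑< n (f ∘ suc) ≡ ∑< n f
∑<-shift n f f0≡fn = +-cancelˡ-≡ (f 0) _ _ (begin
  ∑< (suc n) f    ≡⟨ ∑<-suc n f ⟩
  ∑< n f + f n    ≡⟨ cong (∑< n f +_) (sym f0≡fn) ⟩
  ∑< n f + f 0    ≡⟨ +-comm (∑< n f) (f 0) ⟩
  f 0 + ∑< n f    ∎)

∑<-+ : ∀ m n (f : ℕ → ℕ) → ∑< (m + n) f ≡ ∑< m f + ∑< n (λ x → f (m + x))
∑<-+ zero    n f = refl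
∑<-+ (suc m) n f = trans (cong (f 0 +_) (∑<-+ m n (f ∘ suc))) (sym (+-assoc (f 0) _ _))

∑<-* : ∀ q p (f : ℕ → ℕ) → ∑< (q * p) f ≡ ∑< q (λ i → ∑< p (λ r → f (i * p + r)))
∑<-* zero    p f = refl
∑<-* (suc q) p f = trans (∑<-+ p (q * p) f) (cong (∑< p f +_) (trans (∑<-* q p (λ x → f (p + x)))
  (∑<-cong q (λ i _ → ∑<-cong p (λ r _ → cong f (sym (+-assoc p (i * p) r)))))))

∑<-blocks : ∀ q p′ (f g : ℕ → ℕ) c → (∀ i → f (i * suc p′) ≡ g i) →
  (∀ i r → r < p′ → f (i * suc p′ + suc r) ≡ c) → ∑< (q * suc p′) f ≡ ∑< q g + q * (p′ * c)
∑<-blocks q p′ f g c f-multiple f-other = begin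
  ∑< (q * suc p′) f                                      ≡⟨ ∑<-* q (suc p′) f ⟩
  ∑< q (λ i → ∑< (suc p′) (λ r → f (i * suc p′ + r)))    ≡⟨ ∑<-cong q (λ i _ → block i) ⟩
  ∑< q (λ i → g i + p′ * c)                              ≡⟨ ∑<-distrib-+ q g (λ _ → p′ * c) ⟩
  ∑< q g + ∑< q (λ _ → p′ * c)                           ≡⟨ cong (∑< q g +_) (∑<-const q (p′ * c)) ⟩
  ∑< q g + q * (p′ * c)                                  ∎
  where
  block : ∀ i → ∑< (suc p′) (λ r → f (i * suc p′ + r)) ≡ g i + p′ * c
  block i = cong₂ _+_ (trans (cong f (+-identityʳ (i * suc p′))) (f-multiple i))
                      (trans (∑<-cong p′ (f-other i)) (∑<-const p′ c))

sum-tabulate : ∀ {n} (f : Fin n → ℕ) (g : ℕ → ℕ) → (∀ i → f i ≡ g (toℕ i)) → sum (tabulate f) ≡ ∑< n g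
sum-tabulate {zero}  f g f≡g = refl
sum-tabulate {suc n} f g f≡g = cong₂ _+_ (f≡g Fin.zero) (sum-tabulate (f ∘ Fin.suc) (g ∘ suc) (f≡g ∘ Fin.suc))

toℕ-mod : ∀ {k} (a : Fin (suc k)) → toℕ a mod suc k ≡ a
toℕ-mod a = trans (Finₚ.fromℕ<-cong _ _ (m<n⇒m%n≡m (Finₚ.toℕ<n a)) _ (Finₚ.toℕ<n a)) (Finₚ.fromℕ<-toℕ a _)

sum-allFin : ∀ k (h : Fin (suc k) → ℕ) → sum (map h (allFin (suc k))) ≡ ∑< (suc k) (λ x → h (x mod suc k))
sum-allFin k h = trans (cong sum (map-tabulate (λ a → a) h))
  (sum-tabulate h (λ x → h (x mod suc k)) (λ a → cong h (sym (toℕ-mod a))))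

indicator : ∀ {A : Set} → Dec A → ℕ
indicator (yes _) = 1
indicator (no _)  = 0

indicator-yes : ∀ {A : Set} → A → (a? : Dec A) → indicator a? ≡ 1
indicator-yes a (yes _) = refl
indicator-yes a (no ¬a) = contradiction a ¬a

indicator-no : ∀ {A : Set} → ¬ A → (a? : Dec A) → indicator a? ≡ 0
indicator-no ¬a (yes a) = contradiction a ¬a
indicator-no ¬a (no _)  = refl

length-filter-applyUpTo : ∀ {P : Pred ℕ _} (P? : Decidable P) (f : ℕ → ℕ) n →
  length (filter P? (applyUpTo f n)) ≡ ∑< n (λ x → indicator (P? (f x)))
length-filter-applyUpTo P? f zero = refl
length-filter-applyUpTo P? f (suc n) with P? (f 0)
... | yes _ = cong suc (length-filter-applyUpTo P? (f ∘ suc) n)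
... | no _  = length-filter-applyUpTo P? (f ∘ suc) n

module _ {A B : Set} where

  length-cartesianProduct : ∀ (xs : List A) (ys : List B) → length (cartesianProduct xs ys) ≡ length xs * length ys
  length-cartesianProduct []       ys = refl
  length-cartesianProduct (x ∷ xs) ys = begin
    length (map (x ,_) ys ++ cartesianProduct xs ys)          ≡⟨ length-++ (map (x ,_) ys) ⟩
    length (map (x ,_) ys) + length (cartesianProduct xs ys)  ≡⟨ cong₂ _+_ (length-map (x ,_) ys) (length-cartesianProduct xs ys) ⟩
    length ys + length xs * length ys                         ∎

  sum-cartesianProduct : ∀ (f : A × B → ℕ) (xs : List A) (ys : List B) →
    sum (map f (cartesianProduct xs ys)) ≡ sum (map (λ x → sum (map (λ y → f (x , y)) ys)) xs)
  sum-cartesianProduct f []       ys = refl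
  sum-cartesianProduct f (x ∷ xs) ys = begin
    sum (map f (map (x ,_) ys ++ cartesianProduct xs ys))                 ≡⟨ cong sum (map-++ f (map (x ,_) ys) _) ⟩
    sum (map f (map (x ,_) ys) ++ map f (cartesianProduct xs ys))         ≡⟨ Sum.sum-++ (map f (map (x ,_) ys)) _ ⟩
    sum (map f (map (x ,_) ys)) + sum (map f (cartesianProduct xs ys))    ≡⟨ cong₂ _+_ (cong sum (sym (map-∘ ys))) (sum-cartesianProduct f xs ys) ⟩
    sum (map (λ y → f (x , y)) ys) + _                                    ∎

[m+n%o]%o≡[m+n]%o : ∀ m n o .{{_ : NonZero o}} → (m + n % o) % o ≡ (m + n) % o
[m+n%o]%o≡[m+n]%o m n o = begin
  (m + n % o) % o            ≡⟨ %-distribˡ-+ m (n % o) o ⟩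
  (m % o + n % o % o) % o    ≡⟨ cong (λ z → (m % o + z) % o) (m%n%n≡m%n n o) ⟩
  (m % o + n % o) % o        ≡⟨ %-distribˡ-+ m n o ⟨
  (m + n) % o                ∎

[m*[n%o]]%o≡[m*n]%o : ∀ m n o .{{_ : NonZero o}} → (m * (n % o)) % o ≡ (m * n) % o
[m*[n%o]]%o≡[m*n]%o m n o = begin
  (m * (n % o)) % o              ≡⟨ %-distribˡ-* m (n % o) o ⟩
  ((m % o) * (n % o % o)) % o    ≡⟨ cong (λ z → ((m % o) * z) % o) (m%n%n≡m%n n o) ⟩
  ((m % o) * (n % o)) % o        ≡⟨ %-distribˡ-* m n o ⟨
  (m * n) % o                    ∎

module _ {k : ℕ} where

  toℕ-pow-C : ∀ d (a : Fin (suc k)) → toℕ (pow (C (suc k)) d a) ≡ (d * toℕ a) % suc k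
  toℕ-pow-C zero    a = refl
  toℕ-pow-C (suc d) a = begin
    toℕ ((toℕ a + toℕ (pow (C (suc k)) d a)) mod suc k)  ≡⟨ Finₚ.toℕ-fromℕ< _ ⟩
    (toℕ a + toℕ (pow (C (suc k)) d a)) % suc k         ≡⟨ cong (λ z → (toℕ a + z) % suc k) (toℕ-pow-C d a) ⟩
    (toℕ a + (d * toℕ a) % suc k) % suc k               ≡⟨ [m+n%o]%o≡[m+n]%o (toℕ a) (d * toℕ a) (suc k) ⟩
    (toℕ a + d * toℕ a) % suc k                         ∎

  pow-C-mod≡ε⇔∣ : ∀ x d → pow (C (suc k)) d (x mod suc k) ≡ ε (C (suc k)) ⇔ suc k ∣ d * x
  pow-C-mod≡ε⇔∣ x d = mk⇔
    (λ pow≡ε → m%n≡0⇒n∣m _ _ (trans (sym toℕ-pow) (cong toℕ pow≡ε)))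
    (λ k+1∣dx → Finₚ.toℕ-injective (trans toℕ-pow (n∣m⇒m%n≡0 _ _ k+1∣dx)))
    where
    toℕ-pow : toℕ (pow (C (suc k)) d (x mod suc k)) ≡ (d * x) % suc k
    toℕ-pow = begin
      toℕ (pow (C (suc k)) d (x mod suc k))  ≡⟨ toℕ-pow-C d (x mod suc k) ⟩
      (d * toℕ (x mod suc k)) % suc k        ≡⟨ cong (λ z → (d * z) % suc k) (Finₚ.toℕ-fromℕ< _) ⟩
      (d * (x % suc k)) % suc k              ≡⟨ [m*[n%o]]%o≡[m*n]%o d x (suc k) ⟩
      (d * x) % suc k                        ∎

  order-C : ∀ x → LeastPositive (λ d → suc k ∣ d * x) (order (C (suc k)) (x mod suc k))
  order-C x = order-leastPositive (C (suc k)) (pow-C-mod≡ε⇔∣ x) (s≤s z≤n)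
    (≤-reflexive (sym (length-tabulate (λ (a : Fin (suc k)) → a)))) (m∣m*n x)

  phiG-C : phiG (C (suc k)) ≡ ∑< (suc k) (λ x → totient (order (C (suc k)) (x mod suc k)))
  phiG-C = sum-allFin k (totient ∘ order (C (suc k)))

module _ {k l : ℕ} where

  private
    G = C (suc k) ×G C (suc l)

  order-C×C : ∀ x y →
    LeastPositive (λ d → suc k ∣ d * x × suc l ∣ d * y) (order G (x mod suc k , y mod suc l))
  order-C×C x y = order-leastPositive G pow≡ε⇔ (s≤s z≤n) |G|≥
    (∣-trans (m∣m*n (suc l)) (m∣m*n x) , ∣-trans (n∣m*n (suc k)) (m∣m*n y))
    where
    pow≡ε⇔ : ∀ d → pow G d (x mod suc k , y mod suc l) ≡ ε G ⇔ (suc k ∣ d * x × suc l ∣ d * y)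
    pow≡ε⇔ d = mk⇔
      (λ pow≡ε → let pow≡ε′ = trans (sym (pow-×G _ _ d)) pow≡ε in
        to (pow-C-mod≡ε⇔∣ x d) (cong proj₁ pow≡ε′) , to (pow-C-mod≡ε⇔∣ y d) (cong proj₂ pow≡ε′))
      (λ (k+1∣dx , l+1∣dy) → trans (pow-×G _ _ d)
        (cong₂ _,_ (from (pow-C-mod≡ε⇔∣ x d) k+1∣dx) (from (pow-C-mod≡ε⇔∣ y d) l+1∣dy)))
    |G|≥ : suc k * suc l ≤ length (elements G)
    |G|≥ = ≤-reflexive (sym (trans (length-cartesianProduct (allFin (suc k)) (allFin (suc l)))
             (cong₂ _*_ (length-tabulate (λ (a : Fin (suc k)) → a)) (length-tabulate (λ (b : Fin (suc l)) → b)))))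

  phiG-C×C : phiG G ≡ ∑< (suc k) (λ x → ∑< (suc l) (λ y → totient (order G (x mod suc k , y mod suc l))))
  phiG-C×C = trans (sum-cartesianProduct φ∘order (allFin (suc k)) (allFin (suc l)))
    (trans (sum-allFin k row) (∑<-cong (suc k) (λ x _ → sum-allFin l (λ b → φ∘order (x mod suc k , b)))))
    where
    φ∘order : Carrier G → ℕ
    φ∘order = totient ∘ order G
    row : Fin (suc k) → ℕ
    row a = sum (map (λ b → φ∘order (a , b)) (allFin (suc l)))

0<r<n⇒n∤i*n+r : ∀ {n r} i → 0 < r → r < n → ¬ n ∣ i * n + r
0<r<n⇒n∤i*n+r i 0<r r<n n∣i*n+r = >⇒∤ {{>-nonZero 0<r}} r<n (∣m+n∣m⇒∣n n∣i*n+r (n∣m*n i))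

module _ {p : ℕ} (p-prime : Prime p) where

  ¬∣⇒coprime : ∀ {x} → ¬ p ∣ x → Coprime x p
  ¬∣⇒coprime ¬p∣x (d∣x , d∣p) with prime⇒irreducible p-prime d∣p
  ... | inj₁ d≡1 = d≡1
  ... | inj₂ refl = contradiction d∣x ¬p∣x

  ¬∣⇒coprime-^ : ∀ {x} → ¬ p ∣ x → ∀ j → Coprime x (p ^ j)
  ¬∣⇒coprime-^ ¬p∣x zero    (_ , d∣1) = ∣1⇒≡1 d∣1
  ¬∣⇒coprime-^ ¬p∣x (suc j) (d∣x , d∣p*p^j) =
    ¬∣⇒coprime-^ ¬p∣x j (d∣x , coprime-divisor (λ (c∣d , c∣p) → ¬∣⇒coprime ¬p∣x (∣-trans c∣d d∣x , c∣p)) d∣p*p^j)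

  ^∣*-cancelʳ : ∀ {d x} j → ¬ p ∣ x → p ^ j ∣ d * x → p ^ j ∣ d
  ^∣*-cancelʳ {d} {x} j ¬p∣x p^j∣dx =
    coprime-divisor (Coprimality.sym (¬∣⇒coprime-^ ¬p∣x j)) (subst (p ^ j ∣_) (*-comm d x) p^j∣dx)

  ^∣*<^⇒∣ : ∀ {d a} j → 0 < a → a < p ^ j → p ^ j ∣ d * a → p ∣ d
  ^∣*<^⇒∣ {d} j 0<a a<p^j p^j∣da with p ∣? d
  ... | yes p∣d = p∣d
  ... | no ¬p∣d = contradiction (^∣*-cancelʳ j ¬p∣d (subst (p ^ j ∣_) (*-comm d _) p^j∣da)) (>⇒∤ {{>-nonZero 0<a}} a<p^j)

module _ {p′ : ℕ} (p-prime : Prime (suc p′)) where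

  private
    p = suc p′

  module _ (j : ℕ) {k : ℕ} (q≡p^j : suc k ≡ p ^ j) where

    private
      q = suc k
      n = p * q
      n≡p^[1+j] : n ≡ p ^ suc j
      n≡p^[1+j] = cong (p *_) q≡p^j

    ∣⇒gcd≢1 : ∀ {y} → p ∣ y → gcd y n ≢ 1
    ∣⇒gcd≢1 p∣y gcd≡1 = ¬prime[1] (subst Prime (∣1⇒≡1 (subst (p ∣_) gcd≡1 (gcd-greatest p∣y (m∣m*n q)))) p-prime)

    ¬∣⇒gcd≡1 : ∀ {y} → ¬ p ∣ y → gcd y n ≡ 1
    ¬∣⇒gcd≡1 ¬p∣y = coprime⇒gcd≡1 (subst (Coprime _) (sym n≡p^[1+j]) (¬∣⇒coprime-^ p-prime ¬p∣y (suc j)))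

    totient-p*q : totient n ≡ q * p′
    totient-p*q = begin
      totient n                                        ≡⟨ cong (length ∘ filter (λ y → gcd y n ≟ 1)) (map-upTo suc n) ⟩
      length (filter (λ y → gcd y n ≟ 1) (applyUpTo suc n))  ≡⟨ length-filter-applyUpTo (λ y → gcd y n ≟ 1) suc n ⟩
      ∑< n (coprime ∘ suc)                             ≡⟨ ∑<-shift n coprime (trans (multiple (p ∣0)) (sym (multiple (m∣m*n q)))) ⟩
      ∑< n coprime                                     ≡⟨ cong (λ m → ∑< m coprime) (*-comm p q) ⟩
      ∑< (q * p) coprime                               ≡⟨ ∑<-blocks q p′ coprime (λ _ → 0) 1 (λ i → multiple (n∣m*n i)) non-multiple ⟩
      ∑< q (λ _ → 0) + q * (p′ * 1)                    ≡⟨ cong₂ _+_ (∑<-const q 0) (cong (q *_) (*-identityʳ p′)) ⟩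
      q * 0 + q * p′                                   ≡⟨ cong (_+ q * p′) (*-zeroʳ q) ⟩
      q * p′                                           ∎
      where
      coprime : ℕ → ℕ
      coprime y = indicator (gcd y n ≟ 1)
      multiple : ∀ {y} → p ∣ y → coprime y ≡ 0
      multiple p∣y = indicator-no (∣⇒gcd≢1 p∣y) _
      non-multiple : ∀ i r → r < p′ → coprime (i * p + suc r) ≡ 1
      non-multiple i r r<p′ = indicator-yes (¬∣⇒gcd≡1 (0<r<n⇒n∤i*n+r i (s≤s z≤n) (s≤s r<p′))) _

    order-C-multiple : ∀ i → order (C n) ((i * p) mod n) ≡ order (C q) (i mod q)
    order-C-multiple i = leastPositive-unique (leastPositive-resp-⇔ n∣⇔q∣ (order-C (i * p))) (order-C i)
      where
      d*[i*p]≡p*[d*i] : ∀ d → d * (i * p) ≡ p * (d * i)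
      d*[i*p]≡p*[d*i] d = trans (sym (*-assoc d i p)) (*-comm (d * i) p)
      n∣⇔q∣ : ∀ d → n ∣ d * (i * p) ⇔ q ∣ d * i
      n∣⇔q∣ d = mk⇔ (λ n∣ → *-cancelˡ-∣ p (subst (n ∣_) (d*[i*p]≡p*[d*i] d) n∣))
                    (λ q∣ → subst (n ∣_) (sym (d*[i*p]≡p*[d*i] d)) (*-monoʳ-∣ p q∣))

    order-C-generator : ∀ {x} → ¬ p ∣ x → order (C n) (x mod n) ≡ n
    order-C-generator {x} ¬p∣x = leastPositive-unique (order-C x) (leastPositive-intro (s≤s z≤n) (m∣m*n x)
      (λ {e} 1≤e n∣ex → ∣⇒≤ {{>-nonZero 1≤e}} (subst (_∣ e) (sym n≡p^[1+j])
        (^∣*-cancelʳ p-prime (suc j) ¬p∣x (subst (_∣ e * x) n≡p^[1+j] n∣ex)))))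

    phiG-C[p*q] : phiG (C n) ≡ phiG (C q) + totient n ^ 2
    phiG-C[p*q] = begin
      phiG (C n)                                        ≡⟨ phiG-C {k + p′ * q} ⟩
      ∑< n φ∘order[n]                                   ≡⟨ cong (λ m → ∑< m φ∘order[n]) (*-comm p q) ⟩
      ∑< (q * p) φ∘order[n]                             ≡⟨ ∑<-blocks q p′ φ∘order[n] φ∘order[q] T multiple generator ⟩
      ∑< q φ∘order[q] + q * (p′ * T)                    ≡⟨ cong₂ _+_ (sym (phiG-C {k})) q*[p′*T]≡T^2 ⟩
      phiG (C q) + T ^ 2                                ∎
      where
      T = totient n
      φ∘order[n] φ∘order[q] : ℕ → ℕ
      φ∘order[n] x = totient (order (C n) (x mod n))
      φ∘order[q] x = totient (order (C q) (x mod q))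
      multiple : ∀ i → φ∘order[n] (i * p) ≡ φ∘order[q] i
      multiple i = cong totient (order-C-multiple i)
      generator : ∀ i r → r < p′ → φ∘order[n] (i * p + suc r) ≡ T
      generator i r r<p′ = cong totient (order-C-generator (0<r<n⇒n∤i*n+r i (s≤s z≤n) (s≤s r<p′)))
      q*[p′*T]≡T^2 : q * (p′ * T) ≡ T ^ 2
      q*[p′*T]≡T^2 = begin
        q * (p′ * T)  ≡⟨ *-assoc q p′ T ⟨
        q * p′ * T    ≡⟨ cong (_* T) totient-p*q ⟨
        T * T         ≡⟨ cong (T *_) (*-identityʳ T) ⟨
        T ^ 2         ∎

  totient-p : totient p ≡ p′
  totient-p = trans (cong totient (sym (*-identityʳ p))) (trans (totient-p*q 0 refl) (*-identityˡ p′))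

  module _ (j : ℕ) {k : ℕ} (q≡p^j : suc k ≡ p ^ j) where

    private
      q = suc k
      G = C q ×G C p

    order-C×C-identity-row : ∀ {y} → 0 < y → y < p → order G (0 mod q , y mod p) ≡ p
    order-C×C-identity-row {y} 0<y y<p = leastPositive-unique (order-C×C 0 y)
      (leastPositive-intro (s≤s z≤n) (subst (q ∣_) (sym (*-zeroʳ p)) (q ∣0) , m∣m*n y)
        (λ {e} 1≤e (_ , p∣ey) → ∣⇒≤ {{>-nonZero 1≤e}} (^∣*<^⇒∣ p-prime 1 0<y
          (subst (y <_) (sym (*-identityʳ p)) y<p) (subst (_∣ e * y) (sym (*-identityʳ p)) p∣ey))))

    order-C×C-other-row : ∀ {x} y → 0 < x → x < q → order G (x mod q , y mod p) ≡ order (C q) (x mod q)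
    order-C×C-other-row {x} y 0<x x<q = leastPositive-unique (order-C×C x y)
      (leastPositive-resp-⇔ (λ d → mk⇔ (λ q∣dx → q∣dx , ∣-trans (p∣d q∣dx) (m∣m*n {d} y)) proj₁) (order-C x))
      where
      p∣d : ∀ {d} → q ∣ d * x → p ∣ d
      p∣d {d} q∣dx = ^∣*<^⇒∣ p-prime j 0<x (subst (x <_) q≡p^j x<q) (subst (_∣ d * x) q≡p^j q∣dx)

    phiG-C[q]×C[p] : phiG G ≡ p * phiG (C q) + (p ∸ 1) * (p ∸ 2)
    phiG-C[q]×C[p] = begin
      phiG G                                                 ≡⟨ phiG-C×C {k} {p′} ⟩
      ∑< p (φ∘order 0) + ∑< k (λ x → ∑< p (φ∘order (suc x)))  ≡⟨ cong₂ _+_ identity-row (∑<-cong k other-row) ⟩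
      1 + p′ * p′ + ∑< k (λ x → p * φ∘order[q] (suc x))      ≡⟨ cong (1 + p′ * p′ +_) (∑<-*ˡ k p (φ∘order[q] ∘ suc)) ⟩
      1 + p′ * p′ + p * ∑< k (φ∘order[q] ∘ suc)              ≡⟨ regroup p′ (∑< k (φ∘order[q] ∘ suc)) ⟩
      p * (1 + ∑< k (φ∘order[q] ∘ suc)) + p′ * (p′ ∸ 1)      ≡⟨ cong (λ z → p * z + p′ * (p′ ∸ 1)) (phiG-C {k}) ⟨
      p * phiG (C q) + (p ∸ 1) * (p ∸ 2)                     ∎
      where
      φ∘order : ℕ → ℕ → ℕ
      φ∘order x y = totient (order G (x mod q , y mod p))
      φ∘order[q] : ℕ → ℕ
      φ∘order[q] x = totient (order (C q) (x mod q))
      -- φ(o(0, 0)) = 1 here, and φ(o(0)) = 1 in the last step, hold by evaluation.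
      identity-row : ∑< p (φ∘order 0) ≡ 1 + p′ * p′
      identity-row = cong (1 +_) (trans (∑<-cong p′ (λ y y<p′ →
        trans (cong totient (order-C×C-identity-row (s≤s z≤n) (s≤s y<p′))) totient-p)) (∑<-const p′ p′))
      other-row : ∀ x → x < k → ∑< p (φ∘order (suc x)) ≡ p * φ∘order[q] (suc x)
      other-row x x<k = trans (∑<-cong p (λ y _ → cong totient (order-C×C-other-row y (s≤s z≤n) (s≤s x<k))))
        (∑<-const p (φ∘order[q] (suc x)))
      regroup : ∀ m s → 1 + m * m + suc m * s ≡ suc m * (1 + s) + m * (m ∸ 1)
      regroup zero    s = sym (+-identityʳ _)
      regroup (suc m) s = regroup-suc m s
        where
        regroup-suc : ∀ m s → 1 + suc m * suc m + suc (suc m) * s ≡ suc (suc m) * (1 + s) + suc m * m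
        regroup-suc = solve-∀

mainTheorem4 : (p m : ℕ) → Prime p → 2 ≤ m →
    (phiG (C (p ^ m)) ≡ phiG (C (p ^ (m ∸ 1))) + totient (p ^ m) ^ 2)
    × (phiG (C (p ^ (m ∸ 1)) ×G C p) ≡ p * phiG (C (p ^ (m ∸ 1))) + (p ∸ 1) * (p ∸ 2))
mainTheorem4 zero _ p-prime _ = contradiction p-prime ¬prime[0]
-- C computes only on successors, so p ^ (m ∸ 1) is exposed as suc k.
mainTheorem4 (suc p′) (suc (suc m)) p-prime (s≤s (s≤s z≤n)) with suc p′ ^ suc m in p^[1+m]≡q
... | zero  = contradiction (sym p^[1+m]≡q) (<⇒≢ (m^n>0 (suc p′) (suc m)))
... | suc k = phiG-C[p*q] p-prime (suc m) (sym p^[1+m]≡q) , phiG-C[q]×C[p] p-prime (suc m) (sym p^[1+m]≡q)
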